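{- The class of $L$-convex polyominoes equals $Av_{\mathfrak{P}}(H,V,S_1,S_2)$, where $H=\left[\begin{array}{ccc}1&0&1\end{array}\right]$, $V=\left[\begin{array}{c}1\\0\\1\end{array}\right]$, $S_1=\left[\begin{array}{cc}1&0\\0&1\end{array}\right]$ and $S_2=\left[\begin{array}{cc}0&1\\1&0\end{array}\right]$.
   Context: A polyomino is a finite edge-connected union of unit cells, identified with the binary matrix of its minimal bounding rectangle (entry $1$ iff the cell belongs to the polyomino). It is convex if each row and column is connected. An internal path is a sequence of distinct cells with consecutive cells edge-adjacent, each pair forming a north, south, east or west step; it is monotone if all its steps lie in one of $\{n,e\},\{n,w\},\{s,e\},\{s,w\}$; a change of direction is a pair of consecutive steps of different types. A convex polyomino is $L$-convex (i.e. $1$-convex) if every two of its cells are joined by a monotone internal path with at most one change of direction. $Av_{\mathfrak{P}}(\mathcal{M})$ is the set of polyominoes whose matrix has no submatrix (obtained by deleting rows and/or columns) in $\mathcal{M}$. -}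

module Defs where

open import Data.Nat using (ℕ; zero; suc; _+_) renaming (_≤_ to _≤ℕ_)
open import Data.Fin using (Fin; zero; suc; toℕ; _<_; _≤_)
open import Data.Bool using (Bool; true; false; if_then_else_)
open import Data.Unit using (⊤)
open import Data.Empty using (⊥)
open import Data.Product using (Σ; ∃; _×_; _,_; proj₁; proj₂)
open import Data.Sum using (_⊎_)
open import Data.List using (List; []; _∷_)
open import Data.List.Relation.Unary.All using (All)
open import Data.List.Relation.Unary.Unique.Propositional using (Unique)
open import Relation.Binary.PropositionalEquality using (_≡_)
open import Relation.Nullary using (¬_)

-- A binary matrix with m rows and n columns. Row 0 is the top row.
Matrix : ℕ → ℕ → Set
Matrix m n = Fin m → Fin n → Bool

Cell : ℕ → ℕ → Set
Cell m n = Fin m × Fin n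

_∋_ : ∀ {m n} → Matrix m n → Cell m n → Set
f ∋ (i , j) = f i j ≡ true

-- Elementary steps: north (row decreases), south, east (column increases), west.
data Step : Set where
  N S E W : Step

Adj : ∀ {m n} → Step → Cell m n → Cell m n → Set
Adj N (i , j) (i' , j') = toℕ i ≡ suc (toℕ i') × j ≡ j'
Adj S (i , j) (i' , j') = suc (toℕ i) ≡ toℕ i' × j ≡ j'
Adj E (i , j) (i' , j') = i ≡ i' × suc (toℕ j) ≡ toℕ j'
Adj W (i , j) (i' , j') = i ≡ i' × toℕ j ≡ suc (toℕ j')

data Walk {m n} (f : Matrix m n) : Cell m n → Cell m n → Set where
  stop : ∀ {c} → f ∋ c → Walk f c c
  step : ∀ {c d e} (s : Step) → f ∋ c → Adj s c d → Walk f d e → Walk f c e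

cellsOf : ∀ {m n} {f : Matrix m n} {c d} → Walk f c d → List (Cell m n)
cellsOf (stop {c} _) = c ∷ []
cellsOf (step {c} _ _ _ w) = c ∷ cellsOf w

stepsOf : ∀ {m n} {f : Matrix m n} {c d} → Walk f c d → List Step
stepsOf (stop _) = []
stepsOf (step s _ _ w) = s ∷ stepsOf w

IsInternalPath : ∀ {m n} {f : Matrix m n} {c d} → Walk f c d → Set
IsInternalPath w = Unique (cellsOf w)

data VDir : Set where
  vN vS : VDir
data HDir : Set where
  hE hW : HDir

InPair : VDir → HDir → Step → Set
InPair vN _ N = ⊤
InPair vS _ S = ⊤
InPair _ hE E = ⊤
InPair _ hW W = ⊤
InPair _ _ _ = ⊥

Monotone : List Step → Set
Monotone ss = Σ VDir λ v → Σ HDir λ h → All (InPair v h) ss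

sameStep : Step → Step → Bool
sameStep N N = true
sameStep S S = true
sameStep E E = true
sameStep W W = true
sameStep _ _ = false

changes : List Step → ℕ
changes [] = 0
changes (a ∷ []) = 0
changes (a ∷ b ∷ r) = (if sameStep a b then 0 else 1) + changes (b ∷ r)

Connected : ∀ {m n} → Matrix m n → Set
Connected f = ∀ c d → f ∋ c → f ∋ d → Walk f c d

-- f is the matrix of the minimal bounding rectangle of a (nonempty)
-- edge-connected union of cells.
record IsPolyomino {m n : ℕ} (f : Matrix m n) : Set where
  field
    rowsNonzero : 1 ≤ℕ m
    colsNonzero : 1 ≤ℕ n
    everyRowUsed : ∀ i → ∃ λ j → f i j ≡ true
    everyColUsed : ∀ j → ∃ λ i → f i j ≡ true
    connected : Connected f

Convex : ∀ {m n} → Matrix m n → Set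
Convex {m} {n} f =
  (∀ (i : Fin m) (j₁ j j₂ : Fin n) → f i j₁ ≡ true → f i j₂ ≡ true →
     j₁ ≤ j → j ≤ j₂ → f i j ≡ true)
  × (∀ (j : Fin n) (i₁ i i₂ : Fin m) → f i₁ j ≡ true → f i₂ j ≡ true →
     i₁ ≤ i → i ≤ i₂ → f i j ≡ true)

LConvex : ∀ {m n} → Matrix m n → Set
LConvex f = Convex f ×
  (∀ c d → f ∋ c → f ∋ d →
     Σ (Walk f c d) λ w → IsInternalPath w × Monotone (stepsOf w) × changes (stepsOf w) ≤ℕ 1)

StrictlyIncreasing : ∀ {k m} → (Fin k → Fin m) → Set
StrictlyIncreasing r = ∀ a b → a < b → r a < r b

Contains : ∀ {m n k l} → Matrix m n → Matrix k l → Set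
Contains {m} {n} {k} {l} f M =
  Σ (Fin k → Fin m) λ r → Σ (Fin l → Fin n) λ c →
    StrictlyIncreasing r × StrictlyIncreasing c × (∀ a b → f (r a) (c b) ≡ M a b)

Avoids : ∀ {m n k l} → Matrix m n → Matrix k l → Set
Avoids f M = ¬ Contains f M

H : Matrix 1 3
H _ zero = true
H _ (suc zero) = false
H _ (suc (suc zero)) = true

V : Matrix 3 1
V zero _ = true
V (suc zero) _ = false
V (suc (suc zero)) _ = true

S₁ : Matrix 2 2
S₁ zero zero = true
S₁ zero (suc zero) = false
S₁ (suc zero) zero = false
S₁ (suc zero) (suc zero) = true

S₂ : Matrix 2 2
S₂ zero zero = false
S₂ zero (suc zero) = true
S₂ (suc zero) zero = true
S₂ (suc zero) (suc zero) = false

AvoidsHVS : ∀ {m n} → Matrix m n → Set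
AvoidsHVS f = Avoids f H × Avoids f V × Avoids f S₁ × Avoids f S₂

module Submission where

-- Both sides split into "convexity" and "corner" conditions.  Call f
-- cornered if for any two of its cells c, d one of the two corners
-- (row c, col d), (row d, col c) of the rectangle they span lies in f.
--   * Avoiding H (resp. V) is literally row (resp. column) convexity.
--   * Avoiding S₁ and S₂ is equivalent to being cornered.
--   * L-convex ⇔ convex and cornered.  (⇒) A walk with at most one change
--     of direction runs straight along one axis and then straight along an
--     axis again, so it visits one of the two corners (no monotonicity is
--     needed for this).  (⇐) In a convex f, two cells in a common row or
--     column are joined by a straight segment; joining c to a corner and the
--     corner to d gives a walk with one change of direction, it is monotone,
--     and a monotone walk never revisits a cell, so it is an internal path.

open import Defs
open import Data.Nat using (ℕ)
open import Function.Bundles using (_⇔_)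

open import Data.Nat as ℕ using (zero; suc; _+_; z≤n; s≤s)
open import Data.Nat.Properties as ℕP using ()
open import Data.Fin using (Fin; zero; suc; toℕ; fromℕ<)
open import Data.Fin.Properties using (toℕ-injective; toℕ-fromℕ<; toℕ<n)
open import Data.Bool using (Bool; true; false)
open import Data.Unit using (tt)
open import Data.Empty using (⊥; ⊥-elim)
open import Data.Product using (Σ; _×_; _,_; proj₁; proj₂)
open import Data.Sum using (_⊎_; inj₁; inj₂)
open import Data.List using (List; []; _∷_; _++_)
open import Data.List.Relation.Unary.All as All using (All; []; _∷_)
open import Data.List.Relation.Unary.All.Properties using (++⁺)
open import Data.List.Relation.Unary.AllPairs using ([]; _∷_)
open import Relation.Binary.PropositionalEquality
  using (_≡_; _≢_; refl; sym; trans; cong; cong₂; subst; ≢-sym)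
open import Relation.Nullary using (yes; no)
open import Relation.Binary.Definitions using (tri<; tri≈; tri>)
open import Function.Bundles using (mk⇔)

true≢false : true ≢ false
true≢false ()

pattern one = suc zero
pattern two = suc one

sameStep-refl : ∀ a → sameStep a a ≡ true
sameStep-refl N = refl
sameStep-refl S = refl
sameStep-refl E = refl
sameStep-refl W = refl

sameStep-sound : ∀ a b → sameStep a b ≡ true → a ≡ b
sameStep-sound N N _ = refl
sameStep-sound S S _ = refl
sameStep-sound E E _ = refl
sameStep-sound W W _ = refl
sameStep-sound N S ()
sameStep-sound N E ()
sameStep-sound N W ()
sameStep-sound S N ()
sameStep-sound S E ()
sameStep-sound S W ()
sameStep-sound E N ()
sameStep-sound E S ()
sameStep-sound E W ()
sameStep-sound W N ()
sameStep-sound W S ()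
sameStep-sound W E ()

changes-stutter : (a : Step) (l : List Step) → changes (a ∷ a ∷ l) ≡ changes (a ∷ l)
changes-stutter a l rewrite sameStep-refl a = refl

changes-cons : (a : Step) (l : List Step) → changes (a ∷ l) ℕ.≤ suc (changes l)
changes-cons a [] = z≤n
changes-cons a (b ∷ l) with sameStep a b
... | true = ℕP.n≤1+n _
... | false = ℕP.≤-refl

changes-constant : ∀ {a} (l : List Step) → All (_≡ a) l → changes l ≡ 0
changes-constant [] _ = refl
changes-constant (_ ∷ []) _ = refl
changes-constant {a} (_ ∷ _ ∷ l) (refl ∷ refl ∷ rest) =
  trans (changes-stutter a l) (changes-constant (a ∷ l) (refl ∷ rest))

changes-two-runs : ∀ {a b} (l₁ l₂ : List Step) → All (_≡ a) l₁ → All (_≡ b) l₂ →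
                   changes (l₁ ++ l₂) ℕ.≤ 1
changes-two-runs [] l₂ _ run₂ = subst (ℕ._≤ 1) (sym (changes-constant l₂ run₂)) z≤n
changes-two-runs (x ∷ []) l₂ _ run₂ =
  ℕP.≤-trans (changes-cons x l₂) (ℕP.≤-reflexive (cong suc (changes-constant l₂ run₂)))
changes-two-runs {a} (_ ∷ _ ∷ l) l₂ (refl ∷ refl ∷ run₁) run₂ =
  subst (ℕ._≤ 1) (sym (changes-stutter a (l ++ l₂)))
        (changes-two-runs (a ∷ l) l₂ (refl ∷ run₁) run₂)

-- A budget of one change, once spent, forces the rest to be a single run.
spent : ∀ {k} → suc k ℕ.≤ 1 → k ≡ 0
spent p = ℕP.n≤0⇒n≡0 (ℕ.s≤s⁻¹ p)

data Axis : Set where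
  horizontal vertical : Axis

axis : Step → Axis
axis N = vertical
axis S = vertical
axis E = horizontal
axis W = horizontal

opposite : Step → Step
opposite N = S
opposite S = N
opposite E = W
opposite W = E

vStep : VDir → Step
vStep vN = N
vStep vS = S

hStep : HDir → Step
hStep hE = E
hStep hW = W

vStep-inPair : ∀ v h → InPair v h (vStep v)
vStep-inPair vN hE = tt
vStep-inPair vN hW = tt
vStep-inPair vS hE = tt
vStep-inPair vS hW = tt

hStep-inPair : ∀ v h → InPair v h (hStep h)
hStep-inPair vN hE = tt
hStep-inPair vN hW = tt
hStep-inPair vS hE = tt
hStep-inPair vS hW = tt

inPair-cases : ∀ v h s → InPair v h s → s ≡ vStep v ⊎ s ≡ hStep h
inPair-cases vN h N _ = inj₁ refl
inPair-cases vS h S _ = inj₁ refl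
inPair-cases v hE E _ = inj₂ refl
inPair-cases v hW W _ = inj₂ refl
inPair-cases vN hE S ()
inPair-cases vN hW S ()
inPair-cases vS hE N ()
inPair-cases vS hW N ()
inPair-cases vN hW E ()
inPair-cases vS hW E ()
inPair-cases vN hE W ()
inPair-cases vS hE W ()

data Sense : Set where
  ascending descending : Sense

Towards : Sense → ℕ → ℕ → Set
Towards ascending a b = a ℕ.≤ b
Towards descending a b = b ℕ.≤ a

towards-≡ : ∀ σ {a b} → a ≡ b → Towards σ a b
towards-≡ ascending refl = ℕP.≤-refl
towards-≡ descending refl = ℕP.≤-refl

towards-trans : ∀ σ {a b c} → Towards σ a b → Towards σ b c → Towards σ a c
towards-trans ascending p q = ℕP.≤-trans p q
towards-trans descending p q = ℕP.≤-trans q p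

towards-antisym : ∀ σ {a b} → Towards σ a b → Towards σ b a → a ≡ b
towards-antisym ascending p q = ℕP.≤-antisym p q
towards-antisym descending p q = ℕP.≤-antisym q p

-- Monotone walks of the pair {v, h} move rows in sense rowSense v and
-- columns in sense colSense h.
rowSense : VDir → Sense
rowSense vN = descending
rowSense vS = ascending

colSense : HDir → Sense
colSense hE = ascending
colSense hW = descending

pick2 : ∀ {k} → Fin k → Fin k → Fin 2 → Fin k
pick2 x y zero = x
pick2 x y one = y

pick2-increasing : ∀ {k} (x y : Fin k) → toℕ x ℕ.< toℕ y → StrictlyIncreasing (pick2 x y)
pick2-increasing x y _ zero zero ()
pick2-increasing x y x<y zero one _ = x<y
pick2-increasing x y _ one zero ()
pick2-increasing x y _ one one (s≤s ())

pick3 : ∀ {k} → Fin k → Fin k → Fin k → Fin 3 → Fin k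
pick3 x y z zero = x
pick3 x y z one = y
pick3 x y z two = z

pick3-increasing : ∀ {k} (x y z : Fin k) → toℕ x ℕ.< toℕ y → toℕ y ℕ.< toℕ z →
                   StrictlyIncreasing (pick3 x y z)
pick3-increasing x y z _ _ zero zero ()
pick3-increasing x y z x<y _ zero one _ = x<y
pick3-increasing x y z x<y y<z zero two _ = ℕP.<-trans x<y y<z
pick3-increasing x y z _ _ one zero ()
pick3-increasing x y z _ _ one one (s≤s ())
pick3-increasing x y z _ y<z one two _ = y<z
pick3-increasing x y z _ _ two zero ()
pick3-increasing x y z _ _ two one (s≤s ())
pick3-increasing x y z _ _ two two (s≤s (s≤s ()))

pick1-increasing : ∀ {k} (x : Fin k) → StrictlyIncreasing (λ (_ : Fin 1) → x)
pick1-increasing x zero zero ()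

values-distinct : ∀ {k} (g : Fin k → Bool) {a b} → g a ≡ true → g b ≡ false → toℕ a ≢ toℕ b
values-distinct g ga gb e = true≢false (trans (sym ga) (trans (cong g (toℕ-injective e)) gb))

module _ {m n : ℕ} {f : Matrix m n} where

  RowConvex : Set
  RowConvex = ∀ (i : Fin m) (j₁ j j₂ : Fin n) → f i j₁ ≡ true → f i j₂ ≡ true →
     j₁ Data.Fin.≤ j → j Data.Fin.≤ j₂ → f i j ≡ true

  ColConvex : Set
  ColConvex = ∀ (j : Fin n) (i₁ i i₂ : Fin m) → f i₁ j ≡ true → f i₂ j ≡ true →
     i₁ Data.Fin.≤ i → i Data.Fin.≤ i₂ → f i j ≡ true

  Corner : Cell m n → Cell m n → Set
  Corner (i , j) (i' , j') = f i j' ≡ true ⊎ f i' j ≡ true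

  Cornered : Set
  Cornered = ∀ c d → f ∋ c → f ∋ d → Corner c d

  LPath : ∀ {c d} → Walk f c d → Set
  LPath w = IsInternalPath w × Monotone (stepsOf w) × changes (stepsOf w) ℕ.≤ 1

  source : ∀ {c d} → Walk f c d → f ∋ c
  source (stop fc) = fc
  source (step _ fc _ _) = fc

  target : ∀ {c d} → Walk f c d → f ∋ d
  target (stop fd) = fd
  target (step _ _ _ w) = target w

  append : ∀ {c d e} → Walk f c d → Walk f d e → Walk f c e
  append (stop _) w₂ = w₂
  append (step s fc a w) w₂ = step s fc a (append w w₂)

  steps-append : ∀ {c d e} (w₁ : Walk f c d) (w₂ : Walk f d e) →
                 stepsOf (append w₁ w₂) ≡ stepsOf w₁ ++ stepsOf w₂
  steps-append (stop _) w₂ = refl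
  steps-append (step s _ _ w) w₂ = cong (s ∷_) (steps-append w w₂)

  adj-opposite : ∀ s {c d : Cell m n} → Adj s c d → Adj (opposite s) d c
  adj-opposite N (e , e') = sym e , sym e'
  adj-opposite S (e , e') = sym e , sym e'
  adj-opposite E (e , e') = sym e , sym e'
  adj-opposite W (e , e') = sym e , sym e'

  reverse : ∀ {c d} → Walk f c d → Walk f d c
  reverse (stop fc) = stop fc
  reverse (step s fc a w) = append (reverse w) (step (opposite s) (source w) (adj-opposite s a) (stop fc))

  Straight : ∀ {c d} → Step → Walk f c d → Set
  Straight s w = All (_≡ s) (stepsOf w)

  reverse-straight : ∀ {s c d} (w : Walk f c d) → Straight s w → Straight (opposite s) (reverse w)
  reverse-straight (stop _) [] = []
  reverse-straight (step s fc a w) (refl ∷ st) =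
    subst (All (_≡ opposite s)) (sym (steps-append (reverse w) _))
          (++⁺ (reverse-straight w st) (refl ∷ []))

  -- Monotone walks are internal paths: every cell visited lies weakly ahead
  -- of the previous ones (in both coordinates), and a step is strict.

  Ahead : VDir → HDir → Cell m n → Cell m n → Set
  Ahead v h (i , j) (i' , j') = Towards (rowSense v) (toℕ i) (toℕ i') × Towards (colSense h) (toℕ j) (toℕ j')

  ahead-refl : ∀ v h c → Ahead v h c c
  ahead-refl v h c = towards-≡ (rowSense v) refl , towards-≡ (colSense h) refl

  ahead-trans : ∀ {v h c d e} → Ahead v h c d → Ahead v h d e → Ahead v h c e
  ahead-trans {v} {h} (p , q) (p' , q') = towards-trans (rowSense v) p p' , towards-trans (colSense h) q q'

  ahead-antisym : ∀ {v h c d} → Ahead v h c d → Ahead v h d c → c ≡ d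
  ahead-antisym {v} {h} (p , q) (p' , q') =
    cong₂ _,_ (toℕ-injective (towards-antisym (rowSense v) p p'))
              (toℕ-injective (towards-antisym (colSense h) q q'))

  successor-≤ : ∀ {a b} → suc a ≡ b → a ℕ.≤ b
  successor-≤ refl = ℕP.n≤1+n _

  vertical-ahead : ∀ v h {c d} → Adj (vStep v) c d → Ahead v h c d
  vertical-ahead vN h (e , e') = successor-≤ (sym e) , towards-≡ (colSense h) (cong toℕ e')
  vertical-ahead vS h (e , e') = successor-≤ e , towards-≡ (colSense h) (cong toℕ e')

  horizontal-ahead : ∀ v h {c d} → Adj (hStep h) c d → Ahead v h c d
  horizontal-ahead v hE (e , e') = towards-≡ (rowSense v) (cong toℕ e) , successor-≤ e'
  horizontal-ahead v hW (e , e') = towards-≡ (rowSense v) (cong toℕ e) , successor-≤ (sym e')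

  step-ahead : ∀ v h s {c d} → InPair v h s → Adj s c d → Ahead v h c d
  step-ahead v h s p a with inPair-cases v h s p
  ... | inj₁ refl = vertical-ahead v h a
  ... | inj₂ refl = horizontal-ahead v h a

  adj-irrefl : ∀ s {c : Cell m n} → Adj s c c → ⊥
  adj-irrefl N (e , _) = ℕP.1+n≢n (sym e)
  adj-irrefl S (e , _) = ℕP.1+n≢n e
  adj-irrefl E (_ , e) = ℕP.1+n≢n e
  adj-irrefl W (_ , e) = ℕP.1+n≢n (sym e)

  monotone-ahead : ∀ {v h c d} (w : Walk f c d) → All (InPair v h) (stepsOf w) →
                   All (Ahead v h c) (cellsOf w)
  monotone-ahead {v} {h} {c} (stop _) _ = ahead-refl v h c ∷ []
  monotone-ahead {v} {h} {c} (step s _ a w) (p ∷ ps) =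
    ahead-refl v h c ∷ All.map (ahead-trans (step-ahead v h s p a)) (monotone-ahead w ps)

  monotone-internal : ∀ {v h c d} (w : Walk f c d) → All (InPair v h) (stepsOf w) → IsInternalPath w
  monotone-internal (stop _) _ = [] ∷ []
  monotone-internal {v} {h} (step {c} {c'} s _ a w) (p ∷ ps) =
    All.map never-back (monotone-ahead w ps) ∷ monotone-internal w ps
    where
    -- a cell ahead of c' cannot be c, since c' is strictly ahead of c
    never-back : ∀ {x} → Ahead v h c' x → c ≢ x
    never-back ahead refl =
      adj-irrefl s (subst (Adj s c) (sym (ahead-antisym (step-ahead v h s p a) ahead)) a)

  -- Straight segments.  Given a line of cells `place` (a row or a column)
  -- along which f is convex, two cells of f on the line, in increasing
  -- order, are joined by a straight walk inside f.
  module _ {k : ℕ} (s : Step) (place : Fin k → Cell m n)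
           (advance : ∀ {a b} → suc (toℕ a) ≡ toℕ b → Adj s (place a) (place b))
           (line-convex : ∀ {a b c} → f ∋ place a → f ∋ place c →
                          toℕ a ℕ.≤ toℕ b → toℕ b ℕ.≤ toℕ c → f ∋ place b)
    where

    segment-of-length : ∀ gap {a b} → toℕ a + gap ≡ toℕ b → f ∋ place a → f ∋ place b →
                        Σ (Walk f (place a) (place b)) (Straight s)
    segment-of-length zero {a} a≡b fa _ with toℕ-injective (trans (sym (ℕP.+-identityʳ (toℕ a))) a≡b)
    ... | refl = stop fa , []
    segment-of-length (suc gap) {a} {b} a+gap≡b fa fb =
      step s fa (advance (sym next≡)) (proj₁ rest) , refl ∷ proj₂ rest
      where
      shifted : suc (toℕ a) + gap ≡ toℕ b
      shifted = trans (sym (ℕP.+-suc (toℕ a) gap)) a+gap≡b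
      next<k : suc (toℕ a) ℕ.< k
      next<k = ℕP.≤-<-trans (subst (suc (toℕ a) ℕ.≤_) shifted (ℕP.m≤m+n _ gap)) (toℕ<n b)
      next : Fin k
      next = fromℕ< next<k
      next≡ : toℕ next ≡ suc (toℕ a)
      next≡ = toℕ-fromℕ< next<k
      next+gap≡b : toℕ next + gap ≡ toℕ b
      next+gap≡b = trans (cong (_+ gap) next≡) shifted
      f-next : f ∋ place next
      f-next = line-convex fa fb (subst (toℕ a ℕ.≤_) (sym next≡) (ℕP.n≤1+n _))
                                 (subst (toℕ next ℕ.≤_) next+gap≡b (ℕP.m≤m+n _ gap))
      rest : Σ (Walk f (place next) (place b)) (Straight s)
      rest = segment-of-length gap next+gap≡b f-next fb

    segment : ∀ {a b} → toℕ a ℕ.≤ toℕ b → f ∋ place a → f ∋ place b →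
              Σ (Walk f (place a) (place b)) (Straight s)
    segment a≤b = segment-of-length _ (ℕP.m+[n∸m]≡n a≤b)

  reversed : ∀ {s c d} → Σ (Walk f c d) (Straight s) → Σ (Walk f d c) (Straight (opposite s))
  reversed (w , st) = reverse w , reverse-straight w st

  row-segment : RowConvex → ∀ i {j j'} → toℕ j ℕ.≤ toℕ j' → f i j ≡ true → f i j' ≡ true →
                Σ (Walk f (i , j) (i , j')) (Straight E)
  row-segment rc i = segment E (i ,_) (λ e → refl , e) (λ fa fc → rc i _ _ _ fa fc)

  col-segment : ColConvex → ∀ j {i i'} → toℕ i ℕ.≤ toℕ i' → f i j ≡ true → f i' j ≡ true →
                Σ (Walk f (i , j) (i' , j)) (Straight S)
  col-segment cc j = segment S (_, j) (λ e → e , refl) (λ fa fc → cc j _ _ _ fa fc)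

  row-walk : RowConvex → ∀ {i j j'} → f i j ≡ true → f i j' ≡ true →
             Σ HDir λ h → Σ (Walk f (i , j) (i , j')) (Straight (hStep h))
  row-walk rc {i} {j} {j'} fj fj' with toℕ j ℕ.≤? toℕ j'
  ... | yes j≤j' = hE , row-segment rc i j≤j' fj fj'
  ... | no j≰j' = hW , reversed (row-segment rc i (ℕP.≰⇒≥ j≰j') fj' fj)

  col-walk : ColConvex → ∀ {j i i'} → f i j ≡ true → f i' j ≡ true →
             Σ VDir λ v → Σ (Walk f (i , j) (i' , j)) (Straight (vStep v))
  col-walk cc {j} {i} {i'} fi fi' with toℕ i ℕ.≤? toℕ i'
  ... | yes i≤i' = vS , col-segment cc j i≤i' fi fi'
  ... | no i≰i' = vN , reversed (col-segment cc j (ℕP.≰⇒≥ i≰i') fi' fi)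

  two-runs : ∀ {v h a b c d e} → InPair v h a → InPair v h b →
             (w₁ : Walk f c d) (w₂ : Walk f d e) → Straight a w₁ → Straight b w₂ →
             LPath (append w₁ w₂)
  two-runs {v} {h} pa pb w₁ w₂ st₁ st₂ =
    monotone-internal (append w₁ w₂) monotone , (v , h , monotone) ,
    subst (λ l → changes l ℕ.≤ 1) (sym split) (changes-two-runs _ _ st₁ st₂)
    where
    split : stepsOf (append w₁ w₂) ≡ stepsOf w₁ ++ stepsOf w₂
    split = steps-append w₁ w₂
    monotone : All (InPair v h) (stepsOf (append w₁ w₂))
    monotone = subst (All (InPair v h)) (sym split)
                     (++⁺ (All.map (λ { refl → pa }) st₁) (All.map (λ { refl → pb }) st₂))

  -- Convex and cornered: go from c straight to a corner in f, then straight to d.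
  l-path : RowConvex → ColConvex → Cornered → ∀ c d → f ∋ c → f ∋ d → Σ (Walk f c d) LPath
  l-path rc cc corner c d fc fd with corner c d fc fd
  ... | inj₁ f-corner with row-walk rc fc f-corner | col-walk cc f-corner fd
  ...   | h , w₁ , st₁ | v , w₂ , st₂ =
          append w₁ w₂ , two-runs (hStep-inPair v h) (vStep-inPair v h) w₁ w₂ st₁ st₂
  l-path rc cc corner c d fc fd | inj₂ f-corner with col-walk cc fc f-corner | row-walk rc f-corner fd
  ...   | v , w₁ , st₁ | h , w₂ , st₂ =
          append w₁ w₂ , two-runs (vStep-inPair v h) (hStep-inPair v h) w₁ w₂ st₁ st₂

  Preserves : Axis → Cell m n → Cell m n → Set
  Preserves horizontal (i , _) (i' , _) = i ≡ i'
  Preserves vertical (_ , j) (_ , j') = j ≡ j'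

  adj-preserves : ∀ s {c d} → Adj s c d → Preserves (axis s) c d
  adj-preserves N (_ , e) = e
  adj-preserves S (_ , e) = e
  adj-preserves E (e , _) = e
  adj-preserves W (e , _) = e

  preserves-refl : ∀ a {c} → Preserves a c c
  preserves-refl horizontal = refl
  preserves-refl vertical = refl

  preserves-trans : ∀ a {c d e} → Preserves a c d → Preserves a d e → Preserves a c e
  preserves-trans horizontal = trans
  preserves-trans vertical = trans

  -- The corner reached by first moving along the given axis.
  CornerVia : Axis → Cell m n → Cell m n → Set
  CornerVia horizontal (i , _) (_ , j') = f i j' ≡ true
  CornerVia vertical (_ , j) (i' , _) = f i' j ≡ true

  cornerVia-corner : ∀ a {c d} → CornerVia a c d → Corner c d
  cornerVia-corner horizontal = inj₁
  cornerVia-corner vertical = inj₂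

  -- If c and d share a row or a column, both corners are c or d.
  aligned-corner : ∀ a b {c d} → Preserves a c d → f ∋ c → f ∋ d → CornerVia b c d
  aligned-corner horizontal horizontal refl _ fd = fd
  aligned-corner horizontal vertical refl fc _ = fc
  aligned-corner vertical horizontal refl fc _ = fc
  aligned-corner vertical vertical refl _ fd = fd

  shift-corner : ∀ a {c c' d} → Preserves a c c' → CornerVia a c' d → CornerVia a c d
  shift-corner horizontal refl corner = corner
  shift-corner vertical refl corner = corner

  straight-preserves : ∀ s {c d} (w : Walk f c d) → changes (s ∷ stepsOf w) ≡ 0 →
                       Preserves (axis s) c d
  straight-preserves s (stop _) _ = preserves-refl (axis s)
  straight-preserves s (step t _ adj w) none with sameStep s t in same
  ... | true with sameStep-sound s t same
  ...   | refl = preserves-trans (axis s) (adj-preserves s adj) (straight-preserves s w none)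
  straight-preserves s (step t _ _ _) () | false

  turn : ∀ s {c d} (w : Walk f c d) → changes (s ∷ stepsOf w) ℕ.≤ 1 → CornerVia (axis s) c d
  turn s (stop fc) _ = aligned-corner (axis s) (axis s) (preserves-refl (axis s)) fc fc
  turn s (step t fc adj w) budget with sameStep s t in same
  ... | true with sameStep-sound s t same
  ...   | refl = shift-corner (axis s) (adj-preserves s adj) (turn s w budget)
  turn s (step t fc adj w) budget | false =
    aligned-corner (axis t) (axis s)
      (preserves-trans (axis t) (adj-preserves t adj) (straight-preserves t w (spent budget)))
      fc (target w)

  walk-corner : ∀ {c d} (w : Walk f c d) → changes (stepsOf w) ℕ.≤ 1 → Corner c d
  walk-corner (stop fc) _ = inj₁ fc
  walk-corner w@(step t _ _ w') budget =
    cornerVia-corner (axis t) (turn t w (subst (ℕ._≤ 1) (sym (changes-stutter t (stepsOf w'))) budget))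

  lconvex-cornered : LConvex f → Cornered
  lconvex-cornered (_ , paths) c d fc fd with paths c d fc fd
  ... | w , _ , _ , budget = walk-corner w budget

  -- Convexity forbids H and V: an occurrence is a gap inside a row or column.
  avoidsH : RowConvex → Avoids f H
  avoidsH rc (r , c , _ , c↑ , occ) =
    true≢false (trans (sym (rc (r zero) (c zero) (c one) (c two) (occ zero zero) (occ zero two)
                              (ℕP.<⇒≤ (c↑ zero one (s≤s z≤n))) (ℕP.<⇒≤ (c↑ one two (s≤s (s≤s z≤n))))))
                      (occ zero one))

  avoidsV : ColConvex → Avoids f V
  avoidsV cc (r , c , r↑ , _ , occ) =
    true≢false (trans (sym (cc (c zero) (r zero) (r one) (r two) (occ zero zero) (occ two zero)
                              (ℕP.<⇒≤ (r↑ zero one (s≤s z≤n))) (ℕP.<⇒≤ (r↑ one two (s≤s (s≤s z≤n))))))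
                      (occ one zero))

  -- Conversely, a gap in a row (column) between two cells of f is an
  -- occurrence of H (V).
  rowConvex : Avoids f H → RowConvex
  rowConvex avoid i j₁ j j₂ f₁ f₂ j₁≤j j≤j₂ with f i j in fj
  ... | true = refl
  ... | false = ⊥-elim (avoid ((λ _ → i) , pick3 j₁ j j₂ , pick1-increasing i ,
                               pick3-increasing j₁ j j₂ j₁<j j<j₂ , occ))
    where
    j₁<j : toℕ j₁ ℕ.< toℕ j
    j₁<j = ℕP.≤∧≢⇒< j₁≤j (values-distinct (f i) f₁ fj)
    j<j₂ : toℕ j ℕ.< toℕ j₂
    j<j₂ = ℕP.≤∧≢⇒< j≤j₂ (≢-sym (values-distinct (f i) f₂ fj))
    occ : ∀ a b → f i (pick3 j₁ j j₂ b) ≡ H a b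
    occ zero zero = f₁
    occ zero one = fj
    occ zero two = f₂

  colConvex : Avoids f V → ColConvex
  colConvex avoid j i₁ i i₂ f₁ f₂ i₁≤i i≤i₂ with f i j in fi
  ... | true = refl
  ... | false = ⊥-elim (avoid (pick3 i₁ i i₂ , (λ _ → j) , pick3-increasing i₁ i i₂ i₁<i i<i₂ ,
                               pick1-increasing j , occ))
    where
    column : Fin m → Bool
    column x = f x j
    i₁<i : toℕ i₁ ℕ.< toℕ i
    i₁<i = ℕP.≤∧≢⇒< i₁≤i (values-distinct column f₁ fi)
    i<i₂ : toℕ i ℕ.< toℕ i₂
    i<i₂ = ℕP.≤∧≢⇒< i≤i₂ (≢-sym (values-distinct column f₂ fi))
    occ : ∀ a b → f (pick3 i₁ i i₂ a) j ≡ V a b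
    occ zero zero = f₁
    occ one zero = fi
    occ two zero = f₂

  -- The two 1-entries of an occurrence of S₁ or S₂ span a rectangle whose
  -- corners are its 0-entries, so cornered matrices avoid both.
  avoidsS₁ : Cornered → Avoids f S₁
  avoidsS₁ corner (r , c , _ , _ , occ) with corner (r zero , c zero) (r one , c one) (occ zero zero) (occ one one)
  ... | inj₁ f-corner = true≢false (trans (sym f-corner) (occ zero one))
  ... | inj₂ f-corner = true≢false (trans (sym f-corner) (occ one zero))

  avoidsS₂ : Cornered → Avoids f S₂
  avoidsS₂ corner (r , c , _ , _ , occ) with corner (r zero , c one) (r one , c zero) (occ zero one) (occ one zero)
  ... | inj₁ f-corner = true≢false (trans (sym f-corner) (occ zero zero))
  ... | inj₂ f-corner = true≢false (trans (sym f-corner) (occ one one))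

  square : ∀ {M : Matrix 2 2} (x y : Fin m) (u v : Fin n) → toℕ x ℕ.< toℕ y → toℕ u ℕ.< toℕ v →
           f x u ≡ M zero zero → f x v ≡ M zero one →
           f y u ≡ M one zero → f y v ≡ M one one → Contains f M
  square {M} x y u v x<y u<v e₀₀ e₀₁ e₁₀ e₁₁ =
    pick2 x y , pick2 u v , pick2-increasing x y x<y , pick2-increasing u v u<v , occ
    where
    occ : ∀ a b → f (pick2 x y a) (pick2 u v b) ≡ M a b
    occ zero zero = e₀₀
    occ zero one = e₀₁
    occ one zero = e₁₀
    occ one one = e₁₁

  -- If both corners of the rectangle spanned by two cells of f are empty,
  -- the four cells form an occurrence of S₁ or of S₂ (the cells cannot share
  -- a row or a column, since the corners would then be the cells themselves).
  cornered : Avoids f S₁ → Avoids f S₂ → Cornered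
  cornered avoid₁ avoid₂ (i₁ , j₁) (i₂ , j₂) fc fd with f i₁ j₂ in e₁ | f i₂ j₁ in e₂
  ... | true | _ = inj₁ refl
  ... | false | true = inj₂ refl
  ... | false | false with ℕP.<-cmp (toℕ i₁) (toℕ i₂) | ℕP.<-cmp (toℕ j₁) (toℕ j₂)
  ...   | tri≈ _ i₁≡i₂ _ | _ with refl ← toℕ-injective i₁≡i₂ = ⊥-elim (true≢false (trans (sym fd) e₁))
  ...   | _ | tri≈ _ j₁≡j₂ _ with refl ← toℕ-injective j₁≡j₂ = ⊥-elim (true≢false (trans (sym fd) e₂))
  ...   | tri< i₁<i₂ _ _ | tri< j₁<j₂ _ _ = ⊥-elim (avoid₁ (square i₁ i₂ j₁ j₂ i₁<i₂ j₁<j₂ fc e₁ e₂ fd))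
  ...   | tri< i₁<i₂ _ _ | tri> _ _ j₂<j₁ = ⊥-elim (avoid₂ (square i₁ i₂ j₂ j₁ i₁<i₂ j₂<j₁ e₁ fc fd e₂))
  ...   | tri> _ _ i₂<i₁ | tri< j₁<j₂ _ _ = ⊥-elim (avoid₂ (square i₂ i₁ j₁ j₂ i₂<i₁ j₁<j₂ e₂ fd fc e₁))
  ...   | tri> _ _ i₂<i₁ | tri> _ _ j₂<j₁ = ⊥-elim (avoid₁ (square i₂ i₁ j₂ j₁ i₂<i₁ j₂<j₁ fd e₂ e₁ fc))

mainTheorem18 : ∀ (m n : ℕ) (f : Matrix m n) → IsPolyomino f →
    (LConvex f ⇔ AvoidsHVS f)
mainTheorem18 m n f _ = mk⇔ lconvex⇒avoids avoids⇒lconvex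
  where
  lconvex⇒avoids : LConvex f → AvoidsHVS f
  lconvex⇒avoids lconvex@((rc , cc) , _) =
    avoidsH rc , avoidsV cc , avoidsS₁ (lconvex-cornered lconvex) , avoidsS₂ (lconvex-cornered lconvex)
  avoids⇒lconvex : AvoidsHVS f → LConvex f
  avoids⇒lconvex (aH , aV , aS₁ , aS₂) =
    (rowConvex aH , colConvex aV) , l-path (rowConvex aH) (colConvex aV) (cornered aS₁ aS₂)
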